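{- Let $q$ be a prime power, let $l\ge 1$ and $r_1,\dots,r_l\ge 1$ be integers, let $\alpha_1,\dots,\alpha_l$ be pairwise distinct elements of $\mathbb{F}_q^*$, and let $\gamma\in\mathbb{F}_q$. Consider the system, in the $r_1+\dots+r_l$ variables $x^{(i)}_j$ ($1\le i\le l$, $1\le j\le r_i$) over $\mathbb{F}_q$, $$\begin{cases}\sum_{i=1}^l\sum_{j=1}^{r_i}x^{(i)}_j=\gamma,\\ \sum_{i=1}^l\alpha_i\sum_{j=1}^{r_i}x^{(i)}_j=0,\\ \prod_{i,j}x^{(i)}_j\neq 0.\end{cases}$$ If $l=1$, its number of solutions is $\psi_{r_1}$ if $\gamma=0$ and $0$ if $\gamma\neq 0$. If $l>1$, its number of solutions is $A_{r_1,\dots,r_l}$ if $\gamma=0$, and $\bigl(\psi_{r_1+\dots+r_l}-A_{r_1,\dots,r_l}\bigr)/(q-1)$ if $\gamma\neq 0$.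
   Context: For $m\ge 0$, $\psi_m$ is the number of $(y_1,\dots,y_m)\in\mathbb{F}_q^m$ with $\sum y_i=0$ and all $y_i\neq0$ ($\psi_0=1$), and $\varphi_m$ is the number of $(y_1,\dots,y_m)\in\mathbb{F}_q^m$ with $\sum y_i=1$ and all $y_i\neq 0$ ($\varphi_0=0$). For positive integers $r_1,\dots,r_l$ the integers $A_{r_1,\dots,r_l}$ are defined recursively by $A_{r_1}=\psi_{r_1}$ and, for $l\ge 2$, $A_{r_1,\dots,r_l}=\psi_{r_1+\dots+r_{l-1}}\varphi_{r_l}+(-1)^{r_l}A_{r_1,\dots,r_{l-1}}$. -}

module Defs where

open import Level using (0ℓ)
open import Algebra.Bundles using (CommutativeRing)
open import Data.Nat as ℕ using (ℕ; zero; suc)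
open import Data.Fin using (Fin; zero; suc)
open import Data.Vec as Vec using (Vec; []; _∷_)
open import Data.List as List using (List; []; _∷_; [_]; length; filter; concatMap; allFin)
open import Data.Integer as ℤ using (ℤ; +_)
open import Data.Product using (∃; _×_; _,_)
open import Relation.Nullary using (¬_; Dec; yes; no)
open import Relation.Nullary.Decidable using (_×-dec_; ¬?)
open import Relation.Binary using (Decidable)
import Data.Vec.Relation.Unary.All as VAll
import Data.Nat.ListAction as ListAction
open import Relation.Binary.PropositionalEquality using (_≡_)

-- A finite field: a commutative ring with decidable equality, 1 ≉ 0,
-- inverses of nonzero elements, and an explicit bijection (up to ≈)
-- between Fin q and its carrier, so that q is its number of elements.
record FiniteField : Set₁ where
  field
    commRing : CommutativeRing 0ℓ 0ℓ
  open CommutativeRing commRing public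
  field
    _≟_       : Decidable _≈_
    q         : ℕ
    enum      : Fin q → Carrier
    enum-inj  : ∀ i j → enum i ≈ enum j → i ≡ j
    enum-surj : ∀ x → ∃ λ i → enum i ≈ x
    1≉0       : ¬ (1# ≈ 0#)
    inverse   : ∀ x → ¬ (x ≈ 0#) → ∃ λ y → x * y ≈ 1#

sumFin : {A : Set} → (A → A → A) → A → (n : ℕ) → (Fin n → A) → A
sumFin _⊕_ e zero    f = e
sumFin _⊕_ e (suc n) f = f zero ⊕ sumFin _⊕_ e n (λ i → f (suc i))

allVecs : (q n : ℕ) → List (Vec (Fin q) n)
allVecs q zero    = [ [] ]
allVecs q (suc n) = concatMap (λ i → List.map (i ∷_) (allVecs q n)) (allFin q)

consFam : {l : ℕ} {B : Fin (suc l) → Set} → B zero → ((i : Fin l) → B (suc i)) → (i : Fin (suc l)) → B i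
consFam v f zero    = v
consFam v f (suc i) = f i

allFams : (q l : ℕ) (r : Fin l → ℕ) → List ((i : Fin l) → Vec (Fin q) (r i))
allFams q zero    r = [ (λ ()) ]
allFams q (suc l) r =
  concatMap (λ v → List.map (λ f → consFam {B = λ i → Vec (Fin q) (r i)} v f) (allFams q l (λ i → r (suc i))))
            (allVecs q (r zero))

count : {A : Set} {P : A → Set} → ((a : A) → Dec (P a)) → List A → ℕ
count P? xs = length (filter P? xs)

sgn : ℕ → ℤ
sgn zero    = + 1
sgn (suc r) = ℤ.- sgn r

module _ (F : FiniteField) where
  open FiniteField F

  ΣF : (n : ℕ) → (Fin n → Carrier) → Carrier
  ΣF = sumFin _+_ 0#

  ΠF : (n : ℕ) → (Fin n → Carrier) → Carrier
  ΠF = sumFin _*_ 1#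

  NZ : Fin q → Set
  NZ a = ¬ (enum a ≈ 0#)

  NZ? : (a : Fin q) → Dec (NZ a)
  NZ? a = ¬? (enum a ≟ 0#)

  ψ : ℕ → ℕ
  ψ m = count (λ (v : Vec (Fin q) m) →
                 (ΣF m (λ i → enum (Vec.lookup v i)) ≟ 0#) ×-dec VAll.all? NZ? v)
              (allVecs q m)

  φ : ℕ → ℕ
  φ m = count (λ (v : Vec (Fin q) m) →
                 (ΣF m (λ i → enum (Vec.lookup v i)) ≟ 1#) ×-dec VAll.all? NZ? v)
              (allVecs q m)

  -- A on the reversed list (r_l ∷ r_{l-1} ∷ … ∷ r_1):
  -- A_{r_1} = ψ_{r_1},  A_{r_1..r_l} = ψ_{r_1+…+r_{l-1}} φ_{r_l} + (-1)^{r_l} A_{r_1..r_{l-1}}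
  Arev : List ℕ → ℤ
  Arev []               = + 0   -- not used (l ≥ 1)
  Arev (r ∷ [])         = + ψ r
  Arev (r ∷ rs@(_ ∷ _)) = (+ ψ (ListAction.sum rs)) ℤ.* (+ φ r) ℤ.+ sgn r ℤ.* Arev rs

  A : (l : ℕ) → (Fin l → ℕ) → ℤ
  A l r = Arev (List.reverse (List.tabulate r))

  inner : (l : ℕ) (r : Fin l → ℕ) → ((i : Fin l) → Vec (Fin q) (r i)) → Fin l → Carrier
  inner l r x i = ΣF (r i) (λ j → enum (Vec.lookup (x i) j))

  nSolutions : (l : ℕ) (r : Fin l → ℕ) (α : Fin l → Carrier) (γ : Carrier) → ℕ
  nSolutions l r α γ =
    count (λ x → (ΣF l (inner l r x) ≟ γ)
                 ×-dec (ΣF l (λ i → α i * inner l r x i) ≟ 0#)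
                 ×-dec ¬? (ΠF l (λ i → ΠF (r i) (λ j → enum (Vec.lookup (x i) j))) ≟ 0#))
          (allFams q l r)

module Submission where

-- For nonzero vectors, E n g = Σ_{y ∈ (F*)ⁿ} g(y₁+⋯+yₙ) splits along
-- concatenation and is invariant under scaling by t ≠ 0; hence N n t = #{y : Σ y = t}
-- is ψₙ for t = 0 and φₙ otherwise, ψₙ = φₙ + (-1)ⁿ, and ψₘ₊ₙ = ψₘψₙ + (q-1)φₘφₙ.
-- For families, M c d counts those with Σ xᵢⱼ = c and Σ αᵢ Σⱼ xᵢⱼ = d.  Scaling gives
-- M c 0 = M 1 0 for c ≠ 0; summing over c gives ψ_{r₁+⋯+rₗ} = M 0 0 + (q-1) M 1 0;
-- peeling off the first block and replacing αᵢ by αᵢ - α₁ gives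
-- M 0 0 = ψ_{r₁} M′ 0 0 + (q-1) φ_{r₁} M′ 1 0 for the remaining l-1 blocks.  Hence
-- M 0 0 satisfies the recursion of A read from its first index, which agrees with
-- the definition of A (A-front); the proposition then follows in a few lines.

open import Defs

module IndicatorSums where

  open import Data.Nat using (ℕ; zero; suc; _+_; _*_)
  open import Data.Nat.Properties
    using (+-assoc; +-identityʳ; *-zeroʳ; *-distribˡ-+; *-distribʳ-+; +-commutativeSemigroup; +-0-commutativeMonoid)
  open import Data.Fin using (Fin; zero; suc)
  open import Data.Fin.Properties using (suc-injective)
  open import Data.List using (List; []; _∷_; _++_; map; concatMap; tabulate; allFin)
  open import Data.Empty using (⊥-elim)
  open import Function using (_⇔_; Equivalence)
  open import Relation.Nullary using (Dec; yes; no)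
  open import Relation.Nullary.Decidable using (_×-dec_; ¬?)
  open import Relation.Binary.PropositionalEquality
  open import Algebra.Properties.CommutativeSemigroup +-commutativeSemigroup using (interchange)
  open import Algebra.Properties.CommutativeMonoid.Sum +-0-commutativeMonoid
    using (sum; ∑-permute)
  open import Data.Fin.Permutation using (permutation)
  open Equivalence using (to; from)

  private variable X Y : Set

  𝟙 : ∀ {p} {P : Set p} → Dec P → ℕ
  𝟙 (yes _) = 1
  𝟙 (no _)  = 0

  𝟙-cong : ∀ {p q} {P : Set p} {Q : Set q} (a : Dec P) (b : Dec Q) → P ⇔ Q → 𝟙 a ≡ 𝟙 b
  𝟙-cong (yes _) (yes _) _   = refl
  𝟙-cong (yes p) (no ¬q) p⇔q = ⊥-elim (¬q (to p⇔q p))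
  𝟙-cong (no ¬p) (yes q) p⇔q = ⊥-elim (¬p (from p⇔q q))
  𝟙-cong (no _)  (no _)  _   = refl

  𝟙-× : ∀ {p q} {P : Set p} {Q : Set q} (a : Dec P) (b : Dec Q) → 𝟙 (a ×-dec b) ≡ 𝟙 a * 𝟙 b
  𝟙-× (yes _) (yes _) = refl
  𝟙-× (yes _) (no _)  = refl
  𝟙-× (no _)  _       = refl

  𝟙-¬ : ∀ {p} {P : Set p} (a : Dec P) → 𝟙 (¬? a) + 𝟙 a ≡ 1
  𝟙-¬ (yes _) = refl
  𝟙-¬ (no _)  = refl

  𝟙-∧-cong : ∀ {p₁ p₂ q₁ q₂} {P₁ : Set p₁} {P₂ : Set p₂} {Q₁ : Set q₁} {Q₂ : Set q₂}
             (a₁ : Dec P₁) (a₂ : Dec P₂) (b₁ : Dec Q₁) (b₂ : Dec Q₂) →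
             P₁ ⇔ Q₁ → (P₁ → P₂ ⇔ Q₂) → 𝟙 a₁ * 𝟙 a₂ ≡ 𝟙 b₁ * 𝟙 b₂
  𝟙-∧-cong (yes p₁) a₂ (yes _) b₂ _ h = cong (_+ 0) (𝟙-cong a₂ b₂ (h p₁))
  𝟙-∧-cong (yes p₁) a₂ (no ¬q₁) b₂ e _ = ⊥-elim (¬q₁ (to e p₁))
  𝟙-∧-cong (no ¬p₁) a₂ (yes q₁) b₂ e _ = ⊥-elim (¬p₁ (from e q₁))
  𝟙-∧-cong (no _) a₂ (no _) b₂ _ _ = refl

  ∑ : List X → (X → ℕ) → ℕ
  ∑ []       w = 0
  ∑ (x ∷ xs) w = w x + ∑ xs w

  count-∑ : {P : X → Set} (P? : ∀ a → Dec (P a)) (xs : List X) →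
            count P? xs ≡ ∑ xs (λ x → 𝟙 (P? x))
  count-∑ P? []       = refl
  count-∑ P? (x ∷ xs) with P? x
  ... | yes _ = cong suc (count-∑ P? xs)
  ... | no _  = count-∑ P? xs

  ∑-cong : (xs : List X) {w w′ : X → ℕ} → (∀ x → w x ≡ w′ x) → ∑ xs w ≡ ∑ xs w′
  ∑-cong []       _ = refl
  ∑-cong (x ∷ xs) h = cong₂ _+_ (h x) (∑-cong xs h)

  ∑-zero : (xs : List X) {w : X → ℕ} → (∀ x → w x ≡ 0) → ∑ xs w ≡ 0
  ∑-zero []       _ = refl
  ∑-zero (x ∷ xs) h = cong₂ _+_ (h x) (∑-zero xs h)

  ∑-+ : (xs : List X) (v w : X → ℕ) → ∑ xs (λ x → v x + w x) ≡ ∑ xs v + ∑ xs w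
  ∑-+ []       v w = refl
  ∑-+ (x ∷ xs) v w = trans (cong (v x + w x +_) (∑-+ xs v w)) (interchange (v x) (w x) _ _)

  ∑-*ˡ : (xs : List X) (c : ℕ) (w : X → ℕ) → ∑ xs (λ x → c * w x) ≡ c * ∑ xs w
  ∑-*ˡ []       c w = sym (*-zeroʳ c)
  ∑-*ˡ (x ∷ xs) c w = trans (cong (c * w x +_) (∑-*ˡ xs c w)) (sym (*-distribˡ-+ c (w x) _))

  ∑-*ʳ : (xs : List X) (c : ℕ) (w : X → ℕ) → ∑ xs (λ x → w x * c) ≡ ∑ xs w * c
  ∑-*ʳ []       c w = refl
  ∑-*ʳ (x ∷ xs) c w = trans (cong (w x * c +_) (∑-*ʳ xs c w)) (sym (*-distribʳ-+ c (w x) _))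

  ∑-++ : (xs ys : List X) (w : X → ℕ) → ∑ (xs ++ ys) w ≡ ∑ xs w + ∑ ys w
  ∑-++ []       ys w = refl
  ∑-++ (x ∷ xs) ys w = trans (cong (w x +_) (∑-++ xs ys w)) (sym (+-assoc (w x) _ _))

  ∑-map : (f : X → Y) (xs : List X) (w : Y → ℕ) → ∑ (map f xs) w ≡ ∑ xs (λ x → w (f x))
  ∑-map f []       w = refl
  ∑-map f (x ∷ xs) w = cong (w (f x) +_) (∑-map f xs w)

  ∑-concatMap : (f : X → List Y) (xs : List X) (w : Y → ℕ) →
                ∑ (concatMap f xs) w ≡ ∑ xs (λ x → ∑ (f x) w)
  ∑-concatMap f []       w = refl
  ∑-concatMap f (x ∷ xs) w = trans (∑-++ (f x) _ w) (cong (∑ (f x) w +_) (∑-concatMap f xs w))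

  ∑-comm : (xs : List X) (ys : List Y) (w : X → Y → ℕ) →
           ∑ xs (λ x → ∑ ys (w x)) ≡ ∑ ys (λ y → ∑ xs (λ x → w x y))
  ∑-comm []       ys w = sym (∑-zero ys (λ _ → refl))
  ∑-comm (x ∷ xs) ys w = trans (cong (∑ ys (w x) +_) (∑-comm xs ys w)) (sym (∑-+ ys (w x) _))

  ∑-tabulate : ∀ {n} (f : Fin n → X) (w : X → ℕ) → ∑ (tabulate f) w ≡ sum (λ i → w (f i))
  ∑-tabulate {n = zero}  f w = refl
  ∑-tabulate {n = suc n} f w = cong (w (f zero) +_) (∑-tabulate (λ i → f (suc i)) w)

  ∑-allFin : ∀ {n} (w : Fin n → ℕ) → ∑ (allFin n) w ≡ sum w
  ∑-allFin w = ∑-tabulate (λ i → i) w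

  ∑-ones : ∀ n → ∑ (allFin n) (λ _ → 1) ≡ n
  ∑-ones n = trans (∑-allFin {n} (λ _ → 1)) (ones n)
    where
    ones : ∀ n → sum {n} (λ _ → 1) ≡ n
    ones zero    = refl
    ones (suc n) = cong suc (ones n)

  ∑-bijection : ∀ {n} (σ τ : Fin n → Fin n) → (∀ a → σ (τ a) ≡ a) → (∀ a → τ (σ a) ≡ a) →
                (w : Fin n → ℕ) → ∑ (allFin n) (λ a → w (σ a)) ≡ ∑ (allFin n) w
  ∑-bijection {n} σ τ στ τσ w = begin
    ∑ (allFin n) (λ a → w (σ a)) ≡⟨ ∑-allFin (λ a → w (σ a)) ⟩
    sum (λ a → w (σ a))          ≡⟨ ∑-permute w (permutation σ τ στ τσ) ⟨
    sum w                        ≡⟨ ∑-allFin w ⟨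
    ∑ (allFin n) w               ∎
    where open ≡-Reasoning

  ∑-unique : ∀ {n} {P : Fin n → Set} (P? : ∀ a → Dec (P a)) (w : Fin n → ℕ) (i : Fin n) →
             P i → (∀ a → P a → a ≡ i) → ∑ (allFin n) (λ a → 𝟙 (P? a) * w a) ≡ w i
  ∑-unique P? w i Pi uniq = trans (∑-allFin (λ a → 𝟙 (P? a) * w a)) (go P? w i Pi uniq)
    where
    go : ∀ {n} {P : Fin n → Set} (P? : ∀ a → Dec (P a)) (w : Fin n → ℕ) (i : Fin n) →
         P i → (∀ a → P a → a ≡ i) → sum (λ a → 𝟙 (P? a) * w a) ≡ w i
    go P? w zero Pi uniq with P? zero
    ... | no ¬P0 = ⊥-elim (¬P0 Pi)
    ... | yes _  = trans (cong₂ _+_ (+-identityʳ (w zero)) rest0) (+-identityʳ (w zero))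
      where
      rest0 : sum (λ a → 𝟙 (P? (suc a)) * w (suc a)) ≡ 0
      rest0 = trans (sym (∑-allFin (λ a → 𝟙 (P? (suc a)) * w (suc a)))) (∑-zero (allFin _) absent)
        where
        absent : ∀ a → 𝟙 (P? (suc a)) * w (suc a) ≡ 0
        absent a with P? (suc a)
        ... | yes Pa with () ← uniq (suc a) Pa
        ... | no _   = refl
    go P? w (suc i) Pi uniq with P? zero
    ... | yes P0 with () ← uniq zero P0
    ... | no _   = go (λ a → P? (suc a)) (λ a → w (suc a)) i Pi
                      (λ a Pa → suc-injective (uniq (suc a) Pa))

module Counting (F : FiniteField) where

  open IndicatorSums
  open import Data.Nat using (ℕ; zero; suc) renaming (_+_ to _+ℕ_; _*_ to _*ℕ_)
  import Data.Nat.Properties as ℕP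
  open import Data.Fin using (Fin; zero; suc)
  open import Data.Fin.Properties using (suc-injective)
  open import Data.Vec using (Vec; []; _∷_; lookup)
  import Data.Vec.Relation.Unary.All as All
  open import Data.List using (List; []; _∷_; _++_; [_]; allFin; map; concatMap; tabulate; reverse; length)
  open import Data.List.Properties using (unfold-reverse; length-reverse)
  open import Data.List.Relation.Binary.Permutation.Propositional.Properties using (↭-reverse)
  import Data.Nat.ListAction as ListAction
  import Data.Nat.ListAction.Properties as ListActionP
  open import Data.Product using (_,_; proj₁; proj₂)
  open import Function using (_⇔_; mk⇔; Equivalence)
  open import Function.Construct.Composition using (_⇔-∘_)
  open import Relation.Nullary using (¬_; yes; no)
  open import Data.Empty using (⊥-elim)
  open import Relation.Nullary.Decidable using (¬?; _×-dec_)
  import Relation.Binary.PropositionalEquality as ≡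
  open import Data.Integer as ℤ using (ℤ; +_)
  import Data.Integer.Properties as ℤP
  open import Data.Integer.Tactic.RingSolver using (solve-∀)
  open ≡ using (_≡_; _≢_)
  open import Algebra.Properties.CommutativeSemigroup ℕP.*-commutativeSemigroup using (x∙yz≈y∙xz; x∙yz≈xz∙y; xy∙z≈xz∙y)
  open FiniteField F hiding (zero)
  import Relation.Binary.Reasoning.Setoid setoid as ≈-Reasoning
  open import Algebra.Properties.Group +-group
    using (\\-leftDividesˡ; \\-leftDividesʳ; //-rightDividesˡ; ⁻¹-injective; ε⁻¹≈ε; x∙y⁻¹≈ε⇒x≈y; ∙-cancelʳ)
  import Algebra.Solver.Ring.NaturalCoefficients.Default as NaturalSolver
  open NaturalSolver commutativeSemiring using (solve; _:+_; _:*_; _:=_)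
  open Equivalence using (to; from)

  *-cancelˡ : ∀ {t x y} → ¬ t ≈ 0# → t * x ≈ t * y → x ≈ y
  *-cancelˡ {t} {x} {y} t≉0 tx≈ty with inverse t t≉0
  ... | t⁻¹ , tt⁻¹≈1 = begin
    x              ≈⟨ undo x ⟨
    t⁻¹ * (t * x)  ≈⟨ *-congˡ tx≈ty ⟩
    t⁻¹ * (t * y)  ≈⟨ undo y ⟩
    y              ∎
    where
    open ≈-Reasoning
    undo : ∀ z → t⁻¹ * (t * z) ≈ z
    undo z = trans (solve 3 (λ a b c → a :* (b :* c) := (b :* a) :* c) refl t⁻¹ t z)
                   (trans (*-congʳ tt⁻¹≈1) (*-identityˡ z))

  nonzero-* : ∀ {x y} → ¬ x ≈ 0# → ¬ y ≈ 0# → ¬ x * y ≈ 0#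
  nonzero-* x≉0 y≉0 xy≈0 = y≉0 (*-cancelˡ x≉0 (trans xy≈0 (sym (zeroʳ _))))

  +-solveʳ : ∀ x y z → (x + y ≈ z) ⇔ (y ≈ - x + z)
  +-solveʳ x y z = mk⇔ (λ e → trans (sym (\\-leftDividesʳ x y)) (+-congˡ e))
                       (λ e → trans (+-congˡ e) (\\-leftDividesˡ x z))

  neg≈0⇔ : ∀ {x} → (- x ≈ 0#) ⇔ (x ≈ 0#)
  neg≈0⇔ = mk⇔ (λ e → ⁻¹-injective (trans e (sym ε⁻¹≈ε)))
                 (λ e → trans (-‿cong e) ε⁻¹≈ε)

  neg≉0 : ∀ {x} → ¬ x ≈ 0# → ¬ - x ≈ 0#
  neg≉0 x≉0 e = x≉0 (to neg≈0⇔ e)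

  ≈-⇔ : ∀ {u v w} → u ≈ v → (u ≈ w) ⇔ (v ≈ w)
  ≈-⇔ u≈v = mk⇔ (trans (sym u≈v)) (trans u≈v)

  χ : Carrier → Carrier → ℕ
  χ c x = 𝟙 (x ≟ c)

  ν : Carrier → ℕ
  ν x = 𝟙 (¬? (x ≟ 0#))

  Respects : (Carrier → ℕ) → Set
  Respects f = ∀ {x y} → x ≈ y → f x ≡ f y

  Respects₂ : (Carrier → Carrier → ℕ) → Set
  Respects₂ g = ∀ {c c′ d d′} → c ≈ c′ → d ≈ d′ → g c d ≡ g c′ d′

  χ-cong : ∀ {c c′ x x′} → c ≈ c′ → x ≈ x′ → χ c x ≡ χ c′ x′
  χ-cong c≈c′ x≈x′ = 𝟙-cong (_ ≟ _) (_ ≟ _)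
    (mk⇔ (λ e → trans (sym x≈x′) (trans e c≈c′)) (λ e → trans x≈x′ (trans e (sym c≈c′))))

  χ-sym : ∀ c x → χ c x ≡ χ x c
  χ-sym c x = 𝟙-cong (x ≟ c) (c ≟ x) (mk⇔ sym sym)

  χ-shift : ∀ x y z → χ z (x + y) ≡ χ (- x + z) y
  χ-shift x y z = 𝟙-cong ((x + y) ≟ z) (y ≟ (- x + z)) (+-solveʳ x y z)

  χ-scale : ∀ {t} → ¬ t ≈ 0# → ∀ c x → χ (t * c) (t * x) ≡ χ c x
  χ-scale t≉0 c x = 𝟙-cong (_ ≟ _) (x ≟ c) (mk⇔ (*-cancelˡ t≉0) *-congˡ)

  χ-self : ∀ c → χ c c ≡ 1
  χ-self c with c ≟ c
  ... | yes _  = ≡.refl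
  ... | no c≉c = ⊥-elim (c≉c refl)

  χ-off : ∀ {c x} → ¬ x ≈ c → χ c x ≡ 0
  χ-off {c} {x} x≉c with x ≟ c
  ... | yes x≈c = ⊥-elim (x≉c x≈c)
  ... | no _    = ≡.refl

  ν-cong : Respects ν
  ν-cong x≈y = 𝟙-cong (¬? (_ ≟ 0#)) (¬? (_ ≟ 0#)) (mk⇔ (λ h e → h (trans x≈y e)) (λ h e → h (trans (sym x≈y) e)))

  ν-nonzero : ∀ {x} → ¬ x ≈ 0# → ν x ≡ 1
  ν-nonzero {x} x≉0 with x ≟ 0#
  ... | yes x≈0 = ⊥-elim (x≉0 x≈0)
  ... | no _    = ≡.refl

  ν-* : ∀ x y → ν (x * y) ≡ ν x *ℕ ν y
  ν-* x y with x ≟ 0# | y ≟ 0# | (x * y) ≟ 0#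
  ... | yes _   | _       | yes _  = ≡.refl
  ... | yes x≈0 | _       | no xy≉0 = ⊥-elim (xy≉0 (trans (*-congʳ x≈0) (zeroˡ y)))
  ... | no _    | yes _   | yes _  = ≡.refl
  ... | no _    | yes y≈0 | no xy≉0 = ⊥-elim (xy≉0 (trans (*-congˡ y≈0) (zeroʳ x)))
  ... | no x≉0  | no y≉0  | yes xy≈0 = ⊥-elim (nonzero-* x≉0 y≉0 xy≈0)
  ... | no _    | no _    | no _   = ≡.refl

  ν-scale : ∀ {t} → ¬ t ≈ 0# → ∀ x → ν (t * x) ≡ ν x
  ν-scale t≉0 x = ≡.trans (ν-* _ x) (≡.trans (≡.cong (_*ℕ ν x) (ν-nonzero t≉0)) (ℕP.*-identityˡ (ν x)))

  ∑F : (Carrier → ℕ) → ℕ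
  ∑F f = ∑ (allFin q) (λ a → f (enum a))

  ∑F-cong : ∀ {f f′} → (∀ x → f x ≡ f′ x) → ∑F f ≡ ∑F f′
  ∑F-cong h = ∑-cong (allFin q) (λ a → h (enum a))

  index : Carrier → Fin q
  index x = proj₁ (enum-surj x)

  enum-index : ∀ x → enum (index x) ≈ x
  enum-index x = proj₂ (enum-surj x)

  ∑F-point : ∀ c f → Respects f → ∑F (λ x → χ c x *ℕ f x) ≡ f c
  ∑F-point c f f-resp = ≡.trans
    (∑-unique (λ a → enum a ≟ c) (λ a → f (enum a)) (index c) (enum-index c)
              (λ a e → enum-inj a (index c) (trans e (sym (enum-index c)))))
    (f-resp (enum-index c))

  ∑F-χ : ∀ c → ∑F (χ c) ≡ 1
  ∑F-χ c = ≡.trans (∑F-cong (λ x → ≡.sym (ℕP.*-identityʳ (χ c x)))) (∑F-point c (λ _ → 1) (λ _ → ≡.refl))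

  -- Multiplication by t ≉ 0 permutes the field.
  ∑F-scale : ∀ {t} → ¬ t ≈ 0# → ∀ f → Respects f → ∑F (λ x → f (t * x)) ≡ ∑F f
  ∑F-scale {t} t≉0 f f-resp with inverse t t≉0
  ... | t⁻¹ , tt⁻¹≈1 = ≡.trans
    (∑-cong (allFin q) (λ a → f-resp (sym (enum-index (t * enum a)))))
    (∑-bijection (scaleBy t) (scaleBy t⁻¹) (undo tt⁻¹≈1) (undo (trans (*-comm t⁻¹ t) tt⁻¹≈1)) (λ a → f (enum a)))
    where
    scaleBy : Carrier → Fin q → Fin q
    scaleBy u a = index (u * enum a)
    undo : ∀ {u v} → u * v ≈ 1# → ∀ a → scaleBy u (scaleBy v a) ≡ a
    undo {u} {v} uv≈1 a = enum-inj _ a (begin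
      enum (scaleBy u (scaleBy v a)) ≈⟨ enum-index _ ⟩
      u * enum (scaleBy v a)         ≈⟨ *-congˡ (enum-index _) ⟩
      u * (v * enum a)               ≈⟨ *-assoc u v (enum a) ⟨
      (u * v) * enum a               ≈⟨ *-congʳ uv≈1 ⟩
      1# * enum a                    ≈⟨ *-identityˡ (enum a) ⟩
      enum a                         ∎)
      where open ≈-Reasoning

  Z : ℕ
  Z = ∑F ν

  Z+1≡q : Z +ℕ 1 ≡ q
  Z+1≡q = begin
    ∑F ν +ℕ 1                     ≡⟨ ≡.cong (∑F ν +ℕ_) (∑F-χ 0#) ⟨
    ∑F ν +ℕ ∑F (χ 0#)             ≡⟨ ∑-+ (allFin q) _ _ ⟨
    ∑F (λ x → ν x +ℕ χ 0# x)      ≡⟨ ∑F-cong (λ x → 𝟙-¬ (x ≟ 0#)) ⟩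
    ∑ (allFin q) (λ _ → 1)        ≡⟨ ∑-ones q ⟩
    q                             ∎
    where open ≡.≡-Reasoning

  ∑F-radial : ∀ f → Respects f → (∀ x → ¬ x ≈ 0# → f x ≡ f 1#) → ∑F f ≡ f 0# +ℕ Z *ℕ f 1#
  ∑F-radial f f-resp f-rad = begin
    ∑F f                                            ≡⟨ ∑F-cong split ⟩
    ∑F (λ x → χ 0# x *ℕ f x +ℕ ν x *ℕ f 1#)         ≡⟨ ∑-+ (allFin q) _ _ ⟩
    ∑F (λ x → χ 0# x *ℕ f x) +ℕ ∑F (λ x → ν x *ℕ f 1#)
      ≡⟨ ≡.cong₂ _+ℕ_ (∑F-point 0# f f-resp) (∑-*ʳ (allFin q) (f 1#) (λ a → ν (enum a))) ⟩
    f 0# +ℕ Z *ℕ f 1#                               ∎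
    where
    open ≡.≡-Reasoning
    split : ∀ x → f x ≡ χ 0# x *ℕ f x +ℕ ν x *ℕ f 1#
    split x with x ≟ 0#
    ... | yes _   = ≡.sym (≡.trans (ℕP.+-identityʳ _) (ℕP.+-identityʳ (f x)))
    ... | no x≉0  = ≡.trans (f-rad x x≉0) (≡.sym (ℕP.+-identityʳ _))

  ∑-∑F : ∀ {X : Set} (xs : List X) (h : Carrier → X → ℕ) (w : X → ℕ) →
         ∑ xs (λ x → ∑F (λ c → h c x) *ℕ w x) ≡ ∑F (λ c → ∑ xs (λ x → h c x *ℕ w x))
  ∑-∑F xs h w = ≡.trans (∑-cong xs (λ x → ≡.sym (∑-*ʳ (allFin q) (w x) (λ a → h (enum a) x))))
                        (∑-comm xs (allFin q) _)

  vsum vprod : ∀ {n} → Vec (Fin q) n → Carrier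
  vsum  {n} v = ΣF F n (λ i → enum (lookup v i))
  vprod {n} v = ΠF F n (λ i → enum (lookup v i))

  E : ℕ → (Carrier → ℕ) → ℕ
  E n g = ∑ (allVecs q n) (λ v → g (vsum v) *ℕ ν (vprod v))

  E-cong : ∀ n {g g′} → (∀ s → g s ≡ g′ s) → E n g ≡ E n g′
  E-cong n h = ∑-cong (allVecs q n) (λ v → ≡.cong (_*ℕ _) (h (vsum v)))

  E-*ʳ : ∀ n g k → E n (λ s → g s *ℕ k) ≡ E n g *ℕ k
  E-*ʳ n g k = ≡.trans (∑-cong (allVecs q n) (λ v → xy∙z≈xz∙y (g (vsum v)) k _)) (∑-*ʳ (allVecs q n) k _)

  E-∑F : ∀ n (h : Carrier → Carrier → ℕ) → E n (λ s → ∑F (λ c → h c s)) ≡ ∑F (λ c → E n (h c))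
  E-∑F n h = ∑-∑F (allVecs q n) (λ c v → h c (vsum v)) (λ v → ν (vprod v))

  E-zero : ∀ g → E 0 g ≡ g 0#
  E-zero g = ≡.trans (ℕP.+-identityʳ _) (≡.trans (≡.cong (g 0# *ℕ_) (ν-nonzero 1≉0)) (ℕP.*-identityʳ (g 0#)))

  E-suc : ∀ n g → E (suc n) g ≡ ∑F (λ x → ν x *ℕ E n (λ s → g (x + s)))
  E-suc n g = begin
    ∑ (concatMap (λ a → map (a ∷_) (allVecs q n)) (allFin q)) w
      ≡⟨ ∑-concatMap _ (allFin q) w ⟩
    ∑ (allFin q) (λ a → ∑ (map (a ∷_) (allVecs q n)) w)
      ≡⟨ ∑-cong (allFin q) (λ a → ≡.trans (∑-map (a ∷_) (allVecs q n) w) (first a)) ⟩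
    ∑F (λ x → ν x *ℕ E n (λ s → g (x + s)))
      ∎
    where
    open ≡.≡-Reasoning
    w : Vec (Fin q) (suc n) → ℕ
    w v = g (vsum v) *ℕ ν (vprod v)
    first : ∀ a → ∑ (allVecs q n) (λ v → w (a ∷ v)) ≡ ν (enum a) *ℕ E n (λ s → g (enum a + s))
    first a = ≡.trans (∑-cong (allVecs q n) split) (∑-*ˡ (allVecs q n) (ν (enum a)) (λ v → gₐ v *ℕ ν (vprod v)))
      where
      gₐ : Vec (Fin q) n → ℕ
      gₐ v = g (enum a + vsum v)
      split : ∀ v → w (a ∷ v) ≡ ν (enum a) *ℕ (gₐ v *ℕ ν (vprod v))
      split v = ≡.trans (≡.cong (gₐ v *ℕ_) (ν-* (enum a) (vprod v))) (x∙yz≈y∙xz (gₐ v) (ν (enum a)) (ν (vprod v)))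

  E-+ : ∀ m n g → Respects g → E (m +ℕ n) g ≡ E m (λ s → E n (λ s′ → g (s + s′)))
  E-+ zero n g g-resp = ≡.sym (≡.trans (E-zero (λ s → E n (λ s′ → g (s + s′)))) (E-cong n (λ s′ → g-resp (+-identityˡ s′))))
  E-+ (suc m) n g g-resp = begin
    E (suc (m +ℕ n)) g                                         ≡⟨ E-suc (m +ℕ n) g ⟩
    ∑F (λ x → ν x *ℕ E (m +ℕ n) (λ s → g (x + s)))             ≡⟨ ∑F-cong (λ x → ≡.cong (ν x *ℕ_) (split x)) ⟩
    ∑F (λ x → ν x *ℕ E m (λ s → E n (λ s′ → g (x + s + s′))))  ≡⟨ E-suc m (λ s → E n (λ s′ → g (s + s′))) ⟨
    E (suc m) (λ s → E n (λ s′ → g (s + s′)))                  ∎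
    where
    open ≡.≡-Reasoning
    split : ∀ x → E (m +ℕ n) (λ s → g (x + s)) ≡ E m (λ s → E n (λ s′ → g (x + s + s′)))
    split x = ≡.trans (E-+ m n _ (λ e → g-resp (+-congˡ e)))
                      (E-cong m (λ s → E-cong n (λ s′ → g-resp (sym (+-assoc x s s′)))))

  -- Multiplying every entry by t ≉ 0 permutes the nonzero vectors.
  E-scale : ∀ n {t} → ¬ t ≈ 0# → ∀ g → Respects g → E n (λ s → g (t * s)) ≡ E n g
  E-scale zero {t} t≉0 g g-resp = ≡.trans (E-zero (λ s → g (t * s))) (≡.trans (g-resp (zeroʳ t)) (≡.sym (E-zero g)))
  E-scale (suc n) {t} t≉0 g g-resp = begin
    E (suc n) (λ s → g (t * s))                           ≡⟨ E-suc n (λ s → g (t * s)) ⟩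
    ∑F (λ x → ν x *ℕ E n (λ s → g (t * (x + s))))
      ≡⟨ ∑F-cong (λ x → ≡.cong₂ _*ℕ_ (≡.sym (ν-scale t≉0 x)) (distribute x)) ⟩
    ∑F (λ x → h (t * x))                                  ≡⟨ ∑F-scale t≉0 h h-resp ⟩
    ∑F h                                                  ≡⟨ E-suc n g ⟨
    E (suc n) g                                           ∎
    where
    open ≡.≡-Reasoning
    h : Carrier → ℕ
    h y = ν y *ℕ E n (λ s → g (y + s))
    h-resp : Respects h
    h-resp {y} {y′} e = ≡.cong₂ _*ℕ_ (ν-cong e) (E-cong n (λ s → g-resp (+-congʳ {x = s} e)))
    distribute : ∀ x → E n (λ s → g (t * (x + s))) ≡ E n (λ s → g (t * x + s))
    distribute x = ≡.trans (E-cong n (λ s → g-resp (distribˡ t x s)))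
                      (E-scale n t≉0 (λ s → g (t * x + s)) (λ e → g-resp (+-congˡ e)))

  N : ℕ → Carrier → ℕ
  N n t = E n (χ t)

  N-cong : ∀ n {t t′} → t ≈ t′ → N n t ≡ N n t′
  N-cong n t≈t′ = E-cong n (λ s → χ-cong t≈t′ (refl {x = s}))

  E-fibres : ∀ n g → Respects g → E n g ≡ ∑F (λ c → N n c *ℕ g c)
  E-fibres n g g-resp = begin
    E n g                                     ≡⟨ E-cong n (λ s → ≡.sym (pick s)) ⟩
    E n (λ s → ∑F (λ c → χ c s *ℕ g c))       ≡⟨ E-∑F n (λ c s → χ c s *ℕ g c) ⟩
    ∑F (λ c → E n (λ s → χ c s *ℕ g c))       ≡⟨ ∑F-cong (λ c → E-*ʳ n (χ c) (g c)) ⟩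
    ∑F (λ c → N n c *ℕ g c)                   ∎
    where
    open ≡.≡-Reasoning
    pick : ∀ s → ∑F (λ c → χ c s *ℕ g c) ≡ g s
    pick s = ≡.trans (∑F-cong (λ c → ≡.cong (_*ℕ g c) (χ-sym c s))) (∑F-point s g g-resp)

  -- ψ and φ of the paper are N n 0 and N n 1: "all yᵢ ≠ 0" means ∏ yᵢ ≠ 0.
  allNonzero⇔ : ∀ {n} (v : Vec (Fin q) n) → All.All (NZ F) v ⇔ (¬ vprod v ≈ 0#)
  allNonzero⇔ v = mk⇔ (⇒ v) (⇐ v)
    where
    ⇒ : ∀ {n} (v : Vec (Fin q) n) → All.All (NZ F) v → ¬ vprod v ≈ 0#
    ⇒ []      All.[]          = 1≉0
    ⇒ (a ∷ v) (a≉0 All.∷ nzv) = nonzero-* a≉0 (⇒ v nzv)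
    ⇐ : ∀ {n} (v : Vec (Fin q) n) → ¬ vprod v ≈ 0# → All.All (NZ F) v
    ⇐ []      _ = All.[]
    ⇐ (a ∷ v) h = (λ a≈0 → h (trans (*-congʳ a≈0) (zeroˡ _)))
                  All.∷ ⇐ v (λ v≈0 → h (trans (*-congˡ v≈0) (zeroʳ _)))

  count≡N : ∀ n c → count (λ (v : Vec (Fin q) n) → (vsum v ≟ c) ×-dec All.all? (NZ? F) v) (allVecs q n) ≡ N n c
  count≡N n c = ≡.trans (count-∑ _ (allVecs q n)) (∑-cong (allVecs q n) (λ v →
    ≡.trans (𝟙-× (vsum v ≟ c) (All.all? (NZ? F) v))
            (≡.cong (χ c (vsum v) *ℕ_) (𝟙-cong (All.all? (NZ? F) v) (¬? (vprod v ≟ 0#)) (allNonzero⇔ v)))))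

  ψ≡N : ∀ n → ψ F n ≡ N n 0#
  ψ≡N n = count≡N n 0#

  φ≡N : ∀ n → φ F n ≡ N n 1#
  φ≡N n = count≡N n 1#

  N-zero : ∀ n {t} → t ≈ 0# → N n t ≡ ψ F n
  N-zero n t≈0 = ≡.trans (N-cong n t≈0) (≡.sym (ψ≡N n))

  -- Scaling by t ≉ 0 shows that every nonzero target is hit equally often.
  N-nonzero : ∀ n {t} → ¬ t ≈ 0# → N n t ≡ φ F n
  N-nonzero n {t} t≉0 = begin
    E n (χ t)                 ≡⟨ E-scale n t≉0 (χ t) (χ-cong refl) ⟨
    E n (λ s → χ t (t * s))   ≡⟨ E-cong n (λ s → ≡.trans (χ-cong (sym (*-identityʳ t)) refl) (χ-scale t≉0 1# s)) ⟩
    E n (χ 1#)                ≡⟨ φ≡N n ⟨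
    φ F n                     ∎
    where open ≡.≡-Reasoning

  E-radial : ∀ n g → Respects g → (∀ x → ¬ x ≈ 0# → g x ≡ g 1#) →
             E n g ≡ ψ F n *ℕ g 0# +ℕ (Z *ℕ φ F n) *ℕ g 1#
  E-radial n g g-resp g-rad = begin
    E n g                                          ≡⟨ E-fibres n g g-resp ⟩
    ∑F (λ c → N n c *ℕ g c)                        ≡⟨ ∑F-radial _ (λ e → ≡.cong₂ _*ℕ_ (N-cong n e) (g-resp e)) rad ⟩
    N n 0# *ℕ g 0# +ℕ Z *ℕ (N n 1# *ℕ g 1#)
      ≡⟨ ≡.cong₂ (λ a b → a *ℕ g 0# +ℕ Z *ℕ (b *ℕ g 1#)) (ψ≡N n) (φ≡N n) ⟨
    ψ F n *ℕ g 0# +ℕ Z *ℕ (φ F n *ℕ g 1#)          ≡⟨ ≡.cong (ψ F n *ℕ g 0# +ℕ_) (ℕP.*-assoc Z (φ F n) (g 1#)) ⟨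
    ψ F n *ℕ g 0# +ℕ (Z *ℕ φ F n) *ℕ g 1#          ∎
    where
    open ≡.≡-Reasoning
    rad : ∀ x → ¬ x ≈ 0# → N n x *ℕ g x ≡ N n 1# *ℕ g 1#
    rad x x≉0 = ≡.cong₂ _*ℕ_ (≡.trans (N-nonzero n x≉0) (≡.sym (N-nonzero n 1≉0))) (g-rad x x≉0)

  -- Prepending an entry x ≠ 0, or the entry x = 0 (which does not change the sum),
  -- to all nonzero n-vectors gives each sum t once per choice of x.
  N-suc+N : ∀ n t → N (suc n) t +ℕ N n t ≡ E n (λ _ → 1)
  N-suc+N n t = begin
    N (suc n) t +ℕ N n t                                   ≡⟨ ≡.cong₂ _+ℕ_ (E-suc n (χ t)) (≡.sym at0) ⟩
    ∑F (λ x → ν x *ℕ h x) +ℕ ∑F (λ x → χ 0# x *ℕ h x)      ≡⟨ ∑-+ (allFin q) _ _ ⟨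
    ∑F (λ x → ν x *ℕ h x +ℕ χ 0# x *ℕ h x)                 ≡⟨ ∑F-cong one-choice ⟩
    ∑F h                                                   ≡⟨ E-∑F n (λ x s → χ t (x + s)) ⟨
    E n (λ s → ∑F (λ x → χ t (x + s)))                     ≡⟨ E-cong n once ⟩
    E n (λ _ → 1)                                          ∎
    where
    open ≡.≡-Reasoning
    h : Carrier → ℕ
    h x = E n (λ s → χ t (x + s))
    one-choice : ∀ x → ν x *ℕ h x +ℕ χ 0# x *ℕ h x ≡ h x
    one-choice x = ≡.trans (≡.sym (ℕP.*-distribʳ-+ (h x) (ν x) (χ 0# x)))
                           (≡.trans (≡.cong (_*ℕ h x) (𝟙-¬ (x ≟ 0#))) (ℕP.*-identityˡ (h x)))
    at0 : ∑F (λ x → χ 0# x *ℕ h x) ≡ N n t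
    at0 = ≡.trans (∑F-point 0# h (λ e → E-cong n (λ s → χ-cong (refl {x = t}) (+-congʳ {x = s} e))))
                  (E-cong n (λ s → χ-cong (refl {x = t}) (+-identityˡ s)))
    once : ∀ s → ∑F (λ x → χ t (x + s)) ≡ 1
    once s = ≡.trans (∑F-cong (λ x → ≡.trans (χ-cong (refl {x = t}) (+-comm x s)) (χ-shift s x t))) (∑F-χ (- s + t))

  ψ₀ : ψ F 0 ≡ 1
  ψ₀ = ≡.trans (ψ≡N 0) (≡.trans (E-zero (χ 0#)) (χ-self 0#))

  φ₀ : φ F 0 ≡ 0
  φ₀ = ≡.trans (φ≡N 0) (≡.trans (E-zero (χ 1#)) (χ-off (λ 0≈1 → 1≉0 (sym 0≈1))))

  -- ψₙ = φₙ + (-1)ⁿ, since ψₙ₊₁ + ψₙ and φₙ₊₁ + φₙ both count (F*)ⁿ.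
  ψ≡φ+sgn : ∀ n → + ψ F n ≡ + φ F n ℤ.+ sgn n
  ψ≡φ+sgn zero rewrite ψ₀ | φ₀ = ≡.refl
  ψ≡φ+sgn (suc n) = cancel {s = sgn n} same-total (ψ≡φ+sgn n)
    where
    same-total : ψ F (suc n) +ℕ ψ F n ≡ φ F (suc n) +ℕ φ F n
    same-total = begin
      ψ F (suc n) +ℕ ψ F n   ≡⟨ ≡.cong₂ _+ℕ_ (ψ≡N (suc n)) (ψ≡N n) ⟩
      N (suc n) 0# +ℕ N n 0# ≡⟨ N-suc+N n 0# ⟩
      E n (λ _ → 1)          ≡⟨ N-suc+N n 1# ⟨
      N (suc n) 1# +ℕ N n 1# ≡⟨ ≡.cong₂ _+ℕ_ (φ≡N (suc n)) (φ≡N n) ⟨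
      φ F (suc n) +ℕ φ F n   ∎
      where open ≡.≡-Reasoning
    cancel : ∀ {a b c d s} → a +ℕ b ≡ c +ℕ d → + b ≡ + d ℤ.+ s → + a ≡ + c ℤ.+ ℤ.- s
    cancel {a} {b} {c} {d} {s} a+b≡c+d b≡d+s = begin
      + a                              ≡⟨ add-sub (+ a) (+ b) ⟩
      (+ a ℤ.+ + b) ℤ.- + b            ≡⟨ ≡.cong₂ ℤ._-_ (≡.sym (ℤP.pos-+ a b)) b≡d+s ⟩
      + (a +ℕ b) ℤ.- (+ d ℤ.+ s)       ≡⟨ ≡.cong (λ m → + m ℤ.- (+ d ℤ.+ s)) a+b≡c+d ⟩
      + (c +ℕ d) ℤ.- (+ d ℤ.+ s)       ≡⟨ ≡.cong (ℤ._- (+ d ℤ.+ s)) (ℤP.pos-+ c d) ⟩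
      (+ c ℤ.+ + d) ℤ.- (+ d ℤ.+ s)    ≡⟨ sub-add (+ c) (+ d) s ⟩
      + c ℤ.+ ℤ.- s                    ∎
      where
      open ≡.≡-Reasoning
      add-sub : ∀ x y → x ≡ (x ℤ.+ y) ℤ.- y
      add-sub = solve-∀
      sub-add : ∀ x y z → (x ℤ.+ y) ℤ.- (y ℤ.+ z) ≡ x ℤ.+ ℤ.- z
      sub-add = solve-∀

  -- ψₘ₊ₙ = ψₘψₙ + (q-1) φₘφₙ: split a vector after m entries; the last n entries
  -- must sum to minus the first m, and that count depends only on whether it is zero.
  ψ-+ : ∀ m n → ψ F (m +ℕ n) ≡ ψ F m *ℕ ψ F n +ℕ (Z *ℕ φ F m) *ℕ φ F n
  ψ-+ m n = begin
    ψ F (m +ℕ n)                                 ≡⟨ ψ≡N (m +ℕ n) ⟩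
    E (m +ℕ n) (χ 0#)                            ≡⟨ E-+ m n (χ 0#) (χ-cong refl) ⟩
    E m (λ s → E n (λ s′ → χ 0# (s + s′)))        ≡⟨ E-cong m (λ s → E-cong n (opposite s)) ⟩
    E m (λ s → N n (- s))                        ≡⟨ E-radial m (λ s → N n (- s)) (λ e → N-cong n (-‿cong e)) rad ⟩
    ψ F m *ℕ N n (- 0#) +ℕ (Z *ℕ φ F m) *ℕ N n (- 1#)
                                                 ≡⟨ ≡.cong₂ (λ a b → ψ F m *ℕ a +ℕ (Z *ℕ φ F m) *ℕ b)
                                                      (N-zero n (from (neg≈0⇔ {0#}) refl)) (N-nonzero n (neg≉0 1≉0)) ⟩
    ψ F m *ℕ ψ F n +ℕ (Z *ℕ φ F m) *ℕ φ F n      ∎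
    where
    open ≡.≡-Reasoning
    opposite : ∀ s s′ → χ 0# (s + s′) ≡ χ (- s) s′
    opposite s s′ = ≡.trans (χ-shift s s′ 0#) (χ-cong (+-identityʳ (- s)) refl)
    rad : ∀ x → ¬ x ≈ 0# → N n (- x) ≡ N n (- 1#)
    rad x x≉0 = ≡.trans (N-nonzero n (neg≉0 x≉0)) (≡.sym (N-nonzero n (neg≉0 1≉0)))

  Fam : (l : ℕ) → (Fin l → ℕ) → Set
  Fam l r = (i : Fin l) → Vec (Fin q) (r i)

  total : ∀ l r → Fam l r → Carrier
  total l r x = ΣF F l (inner F l r x)

  weighted : ∀ l r → (Fin l → Carrier) → Fam l r → Carrier
  weighted l r α x = ΣF F l (λ i → α i * inner F l r x i)

  fprod : ∀ l r → Fam l r → Carrier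
  fprod l r x = ΠF F l (λ i → vprod (x i))

  G : ∀ l (r : Fin l → ℕ) → (Fin l → Carrier) → (Carrier → Carrier → ℕ) → ℕ
  G l r α g = ∑ (allFams q l r) (λ x → g (total l r x) (weighted l r α x) *ℕ ν (fprod l r x))

  rest : ∀ {l} {X : Set} → (Fin (suc l) → X) → Fin l → X
  rest f i = f (suc i)

  G-cong : ∀ l r α {g g′} → (∀ c d → g c d ≡ g′ c d) → G l r α g ≡ G l r α g′
  G-cong l r α h = ∑-cong (allFams q l r) (λ x → ≡.cong (_*ℕ _) (h _ _))

  G-zero : ∀ r α g → G 0 r α g ≡ g 0# 0#
  G-zero r α g = ≡.trans (ℕP.+-identityʳ _) (≡.trans (≡.cong (g 0# 0# *ℕ_) (ν-nonzero 1≉0)) (ℕP.*-identityʳ (g 0# 0#)))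

  G-peel : ∀ l r α g → G (suc l) r α g ≡ E (r zero) (λ s → G l (rest r) (rest α) (λ c d → g (s + c) (α zero * s + d)))
  G-peel l r α g = begin
    ∑ (concatMap (λ v → map (cons v) (allFams q l (rest r))) (allVecs q (r zero))) w
      ≡⟨ ∑-concatMap _ (allVecs q (r zero)) w ⟩
    ∑ (allVecs q (r zero)) (λ v → ∑ (map (cons v) (allFams q l (rest r))) w)
      ≡⟨ ∑-cong (allVecs q (r zero)) (λ v → ≡.trans (∑-map (cons v) (allFams q l (rest r)) w) (first v)) ⟩
    E (r zero) (λ s → G l (rest r) (rest α) (λ c d → g (s + c) (α zero * s + d)))
      ∎
    where
    open ≡.≡-Reasoning
    cons : Vec (Fin q) (r zero) → Fam l (rest r) → Fam (suc l) r
    cons v f = consFam {B = λ i → Vec (Fin q) (r i)} v f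
    w : Fam (suc l) r → ℕ
    w x = g (total (suc l) r x) (weighted (suc l) r α x) *ℕ ν (fprod (suc l) r x)
    first : ∀ v → ∑ (allFams q l (rest r)) (λ f → w (cons v f))
                ≡ G l (rest r) (rest α) (λ c d → g (vsum v + c) (α zero * vsum v + d)) *ℕ ν (vprod v)
    first v = ≡.trans (∑-cong (allFams q l (rest r)) split) (∑-*ʳ (allFams q l (rest r)) (ν (vprod v)) _)
      where
      gᵥ : Fam l (rest r) → ℕ
      gᵥ f = g (vsum v + total l (rest r) f) (α zero * vsum v + weighted l (rest r) (rest α) f)
      split : ∀ f → w (cons v f) ≡ gᵥ f *ℕ ν (fprod l (rest r) f) *ℕ ν (vprod v)
      split f = ≡.trans (≡.cong (gᵥ f *ℕ_) (ν-* (vprod v) (fprod l (rest r) f)))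
                        (x∙yz≈xz∙y (gᵥ f) (ν (vprod v)) (ν (fprod l (rest r) f)))

  ΣF-shift : ∀ l (α β S : Fin l → Carrier) a → (∀ i → α i ≈ β i + a) →
             ΣF F l (λ i → α i * S i) ≈ ΣF F l (λ i → β i * S i) + a * ΣF F l S
  ΣF-shift zero    α β S a h = sym (trans (+-congˡ (zeroʳ a)) (+-identityʳ 0#))
  ΣF-shift (suc l) α β S a h = begin
    α zero * S zero + ΣF F l (λ i → α (suc i) * S (suc i))
      ≈⟨ +-cong (*-congʳ (h zero)) (ΣF-shift l (rest α) (rest β) (rest S) a (λ i → h (suc i))) ⟩
    (β zero + a) * S zero + (ΣF F l (λ i → β (suc i) * S (suc i)) + a * ΣF F l (rest S))
      ≈⟨ solve 5 (λ b a s x y → (b :+ a) :* s :+ (x :+ a :* y) := (b :* s :+ x) :+ a :* (s :+ y))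
               refl (β zero) a (S zero) _ _ ⟩
    (β zero * S zero + ΣF F l (λ i → β (suc i) * S (suc i))) + a * (S zero + ΣF F l (rest S))
      ∎
    where open ≈-Reasoning

  G-shift : ∀ l r α β a g → Respects₂ g → (∀ i → α i ≈ β i + a) →
            G l r α g ≡ G l r β (λ c d → g c (d + a * c))
  G-shift l r α β a g g-resp h = ∑-cong (allFams q l r) (λ x →
    ≡.cong (_*ℕ ν (fprod l r x)) (g-resp refl (ΣF-shift l α β (inner F l r x) a h)))

  -- Multiplying every entry by t ≉ 0 permutes the families.
  G-scale : ∀ l r α {t} → ¬ t ≈ 0# → ∀ g → Respects₂ g → G l r α (λ c d → g (t * c) (t * d)) ≡ G l r α g
  G-scale zero r α {t} t≉0 g g-resp =
    ≡.trans (G-zero r α (λ c d → g (t * c) (t * d))) (≡.trans (g-resp (zeroʳ t) (zeroʳ t)) (≡.sym (G-zero r α g)))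
  G-scale (suc l) r α {t} t≉0 g g-resp = begin
    G (suc l) r α (λ c d → g (t * c) (t * d))
      ≡⟨ G-peel l r α (λ c d → g (t * c) (t * d)) ⟩
    E (r zero) (λ s → G l (rest r) (rest α) (λ c d → g (t * (s + c)) (t * (α zero * s + d))))
      ≡⟨ E-cong (r zero) (λ s → ≡.trans (G-cong l (rest r) (rest α) (λ c d → g-resp (distribˡ t s c) (move s d)))
                                         (G-scale l (rest r) (rest α) t≉0 (g′ (t * s)) (g′-resp (t * s)))) ⟩
    E (r zero) (λ s → h (t * s))
      ≡⟨ E-scale (r zero) t≉0 h h-resp ⟩
    E (r zero) h
      ≡⟨ G-peel l r α g ⟨
    G (suc l) r α g
      ∎
    where
    open ≡.≡-Reasoning
    g′ : Carrier → Carrier → Carrier → ℕ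
    g′ s c d = g (s + c) (α zero * s + d)
    g′-resp : ∀ s → Respects₂ (g′ s)
    g′-resp s c≈c′ d≈d′ = g-resp (+-congˡ c≈c′) (+-congˡ d≈d′)
    h : Carrier → ℕ
    h s = G l (rest r) (rest α) (g′ s)
    h-resp : Respects h
    h-resp {s} {s′} e = G-cong l (rest r) (rest α) (λ c d → g-resp (+-congʳ {x = c} e) (+-congʳ {x = d} (*-congˡ e)))
    move : ∀ s d → t * (α zero * s + d) ≈ α zero * (t * s) + t * d
    move s d = solve 4 (λ t a s d → t :* (a :* s :+ d) := a :* (t :* s) :+ t :* d) refl t (α zero) s d

  G-marginal : ∀ l r α → (∀ i → ¬ α i ≈ 0#) → ∀ g → Respects g →
               G l r α (λ _ d → g d) ≡ E (sumFin _+ℕ_ 0 l r) g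
  G-marginal zero    r α α≉0 g g-resp = ≡.trans (G-zero r α (λ _ d → g d)) (≡.sym (E-zero g))
  G-marginal (suc l) r α α≉0 g g-resp = begin
    G (suc l) r α (λ _ d → g d)                              ≡⟨ G-peel l r α (λ _ d → g d) ⟩
    E (r zero) (λ s → G l (rest r) (rest α) (λ _ d → g (α zero * s + d)))
      ≡⟨ E-cong (r zero) (λ s → G-marginal l (rest r) (rest α) (λ i → α≉0 (suc i)) (λ d → g (α zero * s + d))
                                             (λ e → g-resp (+-congˡ e))) ⟩
    E (r zero) (λ s → h (α zero * s))                        ≡⟨ E-scale (r zero) (α≉0 zero) h h-resp ⟩
    E (r zero) h                                             ≡⟨ E-+ (r zero) (sumFin _+ℕ_ 0 l (rest r)) g g-resp ⟨
    E (sumFin _+ℕ_ 0 (suc l) r) g                            ∎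
    where
    open ≡.≡-Reasoning
    h : Carrier → ℕ
    h s = E (sumFin _+ℕ_ 0 l (rest r)) (λ d → g (s + d))
    h-resp : Respects h
    h-resp e = E-cong (sumFin _+ℕ_ 0 l (rest r)) (λ d → g-resp (+-congʳ {x = d} e))

  M : ∀ l r → (Fin l → Carrier) → Carrier → Carrier → ℕ
  M l r α c d = G l r α (λ c′ d′ → χ c c′ *ℕ χ d d′)

  χχ-resp : ∀ c d → Respects₂ (λ c′ d′ → χ c c′ *ℕ χ d d′)
  χχ-resp c d c′≈ d′≈ = ≡.cong₂ _*ℕ_ (χ-cong (refl {x = c}) c′≈) (χ-cong (refl {x = d}) d′≈)

  nSolutions≡M : ∀ l r α γ → nSolutions F l r α γ ≡ M l r α γ 0#
  nSolutions≡M l r α γ = ≡.trans (count-∑ _ (allFams q l r)) (∑-cong (allFams q l r) (λ x →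
    let a = total l r x ≟ γ ; b = weighted l r α x ≟ 0# ; c = ¬? (fprod l r x ≟ 0#) in
    ≡.trans (𝟙-× a (b ×-dec c)) (≡.trans (≡.cong (𝟙 a *ℕ_) (𝟙-× b c)) (≡.sym (ℕP.*-assoc (𝟙 a) (𝟙 b) (𝟙 c))))))

  M-cong : ∀ l r α {c c′ d d′} → c ≈ c′ → d ≈ d′ → M l r α c d ≡ M l r α c′ d′
  M-cong l r α c≈c′ d≈d′ =
    G-cong l r α (λ c″ d″ → ≡.cong₂ _*ℕ_ (χ-cong c≈c′ (refl {x = c″})) (χ-cong d≈d′ (refl {x = d″})))

  M-scale : ∀ l r α {t} → ¬ t ≈ 0# → ∀ c d → M l r α (t * c) (t * d) ≡ M l r α c d
  M-scale l r α {t} t≉0 c d = ≡.trans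
    (≡.sym (G-scale l r α t≉0 _ (χχ-resp (t * c) (t * d))))
    (G-cong l r α (λ c′ d′ → ≡.cong₂ _*ℕ_ (χ-scale t≉0 c c′) (χ-scale t≉0 d d′)))

  M-radial : ∀ l r α {x} → ¬ x ≈ 0# → M l r α x 0# ≡ M l r α 1# 0#
  M-radial l r α {x} x≉0 = ≡.trans (M-cong l r α (sym (*-identityʳ x)) (sym (zeroʳ x))) (M-scale l r α x≉0 1# 0#)

  M-empty : ∀ r α c d → M 0 r α c d ≡ χ c 0# *ℕ χ d 0#
  M-empty r α c d = G-zero r α (λ c′ d′ → χ c c′ *ℕ χ d d′)

  M-empty-off : ∀ r α c {d} → ¬ d ≈ 0# → M 0 r α c d ≡ 0
  M-empty-off r α c {d} d≉0 = ≡.trans (M-empty r α c d) (≡.trans (≡.cong (χ c 0# *ℕ_) off) (ℕP.*-zeroʳ (χ c 0#)))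
    where
    off : χ d 0# ≡ 0
    off = χ-off (λ 0≈d → d≉0 (sym 0≈d))

  ψ-total : ∀ l r α → (∀ i → ¬ α i ≈ 0#) →
            ψ F (sumFin _+ℕ_ 0 l r) ≡ M l r α 0# 0# +ℕ Z *ℕ M l r α 1# 0#
  ψ-total l r α α≉0 = begin
    ψ F (sumFin _+ℕ_ 0 l r)                        ≡⟨ ψ≡N (sumFin _+ℕ_ 0 l r) ⟩
    E (sumFin _+ℕ_ 0 l r) (χ 0#)                   ≡⟨ G-marginal l r α α≉0 (χ 0#) (χ-cong refl) ⟨
    G l r α (λ _ d → χ 0# d)                       ≡⟨ G-cong l r α (λ c′ d → ≡.sym (pick c′ d)) ⟩
    G l r α (λ c′ d → ∑F (λ c → χ c c′ *ℕ χ 0# d))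
      ≡⟨ ∑-∑F (allFams q l r) (λ c x → χ c (total l r x) *ℕ χ 0# (weighted l r α x)) (λ x → ν (fprod l r x)) ⟩
    ∑F (λ c → M l r α c 0#)                        ≡⟨ ∑F-radial _ (λ e → M-cong l r α e refl) (λ _ → M-radial l r α) ⟩
    M l r α 0# 0# +ℕ Z *ℕ M l r α 1# 0#            ∎
    where
    open ≡.≡-Reasoning
    pick : ∀ c′ d → ∑F (λ c → χ c c′ *ℕ χ 0# d) ≡ χ 0# d
    pick c′ d = ≡.trans (∑-*ʳ (allFin q) (χ 0# d) _)
                (≡.trans (≡.cong (_*ℕ χ 0# d) (≡.trans (∑F-cong (λ c → χ-sym c c′)) (∑F-χ c′))) (ℕP.*-identityˡ (χ 0# d)))

  rebase : ∀ {l} → (Fin (suc l) → Carrier) → Fin l → Carrier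
  rebase α i = α (suc i) - α zero

  -- Peeling off the first block (sum s) and rebasing the remaining weights:
  -- Σ_{i>1} Sᵢ = c - s and Σ_{i>1} (αᵢ - α₁) Sᵢ = d - α₁ c.
  M-peel : ∀ l r α c d → M (suc l) r α c d ≡ E (r zero) (λ s → M l (rest r) (rebase α) (- s + c) (- (α zero * c) + d))
  M-peel l r α c d = ≡.trans (G-peel l r α (λ c′ d′ → χ c c′ *ℕ χ d d′)) (E-cong (r zero) (λ s →
    ≡.trans (G-shift l (rest r) (rest α) (rebase α) a (shifted s) (shifted-resp s) rebase-+)
            (G-cong l (rest r) (rebase α) (solved s))))
    where
    a : Carrier
    a = α zero
    shifted : Carrier → Carrier → Carrier → ℕ
    shifted s c′ d′ = χ c (s + c′) *ℕ χ d (a * s + d′)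
    shifted-resp : ∀ s → Respects₂ (shifted s)
    shifted-resp s c′≈ d′≈ = χχ-resp c d (+-congˡ c′≈) (+-congˡ d′≈)
    rebase-+ : ∀ i → α (suc i) ≈ rebase α i + a
    rebase-+ i = sym (//-rightDividesˡ a (α (suc i)))
    solved : ∀ s c′ d′ → χ c (s + c′) *ℕ χ d (a * s + (d′ + a * c′)) ≡ χ (- s + c) c′ *ℕ χ (- (a * c) + d) d′
    solved s c′ d′ = 𝟙-∧-cong ((s + c′) ≟ c) ((a * s + (d′ + a * c′)) ≟ d) (c′ ≟ (- s + c)) (d′ ≟ (- (a * c) + d))
      (+-solveʳ s c′ c) (λ s+c′≈c → +-solveʳ (a * c) d′ d ⇔-∘ ≈-⇔ (regroup s+c′≈c))
      where
      regroup : s + c′ ≈ c → a * s + (d′ + a * c′) ≈ a * c + d′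
      regroup e = trans (solve 4 (λ a s c′ d′ → a :* s :+ (d′ :+ a :* c′) := a :* (s :+ c′) :+ d′) refl a s c′ d′)
                        (+-congʳ (*-congˡ e))

  M-front : ∀ l r α → M (suc l) r α 0# 0# ≡
            ψ F (r zero) *ℕ M l (rest r) (rebase α) 0# 0# +ℕ (Z *ℕ φ F (r zero)) *ℕ M l (rest r) (rebase α) 1# 0#
  M-front l r α = begin
    M (suc l) r α 0# 0#                                      ≡⟨ M-peel l r α 0# 0# ⟩
    E (r zero) (λ s → M′ (- s + 0#) (- (α zero * 0#) + 0#))
      ≡⟨ E-cong (r zero) (λ s → M-cong l (rest r) (rebase α) (+-identityʳ (- s)) origin) ⟩
    E (r zero) (λ s → M′ (- s) 0#)
      ≡⟨ E-radial (r zero) (λ s → M′ (- s) 0#) (λ e → M-cong l (rest r) (rebase α) (-‿cong e) refl) rad ⟩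
    ψ F (r zero) *ℕ M′ (- 0#) 0# +ℕ (Z *ℕ φ F (r zero)) *ℕ M′ (- 1#) 0#
      ≡⟨ ≡.cong₂ (λ a b → ψ F (r zero) *ℕ a +ℕ (Z *ℕ φ F (r zero)) *ℕ b)
                 (M-cong l (rest r) (rebase α) (from neg≈0⇔ refl) refl) (M-radial l (rest r) (rebase α) (neg≉0 1≉0)) ⟩
    ψ F (r zero) *ℕ M′ 0# 0# +ℕ (Z *ℕ φ F (r zero)) *ℕ M′ 1# 0# ∎
    where
    open ≡.≡-Reasoning
    M′ : Carrier → Carrier → ℕ
    M′ = M l (rest r) (rebase α)
    origin : - (α zero * 0#) + 0# ≈ 0#
    origin = trans (+-identityʳ _) (from neg≈0⇔ (zeroʳ (α zero)))
    rad : ∀ x → ¬ x ≈ 0# → M′ (- x) 0# ≡ M′ (- 1#) 0#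
    rad x x≉0 = ≡.trans (M-radial l (rest r) (rebase α) (neg≉0 x≉0)) (≡.sym (M-radial l (rest r) (rebase α) (neg≉0 1≉0)))

  M-single : ∀ r α → M 1 r α 0# 0# ≡ ψ F (r zero)
  M-single r α = begin
    M 1 r α 0# 0#                                            ≡⟨ M-front 0 r α ⟩
    ψ F (r zero) *ℕ M 0 r′ β 0# 0# +ℕ (Z *ℕ φ F (r zero)) *ℕ M 0 r′ β 1# 0#
      ≡⟨ ≡.cong₂ (λ a b → ψ F (r zero) *ℕ a +ℕ (Z *ℕ φ F (r zero)) *ℕ b)
                 (≡.trans (M-empty r′ β 0# 0#) (≡.cong₂ _*ℕ_ (χ-self 0#) (χ-self 0#)))
                 (≡.trans (M-empty r′ β 1# 0#) (≡.cong (_*ℕ χ 0# 0#) (χ-off (λ 0≈1 → 1≉0 (sym 0≈1))))) ⟩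
    ψ F (r zero) *ℕ 1 +ℕ (Z *ℕ φ F (r zero)) *ℕ 0
      ≡⟨ ≡.cong₂ _+ℕ_ (ℕP.*-identityʳ (ψ F (r zero))) (ℕP.*-zeroʳ (Z *ℕ φ F (r zero))) ⟩
    ψ F (r zero) +ℕ 0                                        ≡⟨ ℕP.+-identityʳ _ ⟩
    ψ F (r zero)                                             ∎
    where
    open ≡.≡-Reasoning
    r′ : Fin 0 → ℕ
    r′ = rest r
    β : Fin 0 → Carrier
    β = rebase α

  M-single-off : ∀ r α {c} → ¬ α zero ≈ 0# → ¬ c ≈ 0# → M 1 r α c 0# ≡ 0
  M-single-off r α {c} α₁≉0 c≉0 = ≡.trans (M-peel 0 r α c 0#)
    (≡.trans (E-cong (r zero) (λ s → M-empty-off (rest r) (rebase α) (- s + c) off))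
             (∑-zero (allVecs q (r zero)) (λ _ → ≡.refl)))
    where
    off : ¬ - (α zero * c) + 0# ≈ 0#
    off e = nonzero-* α₁≉0 c≉0 (to neg≈0⇔ (trans (sym (+-identityʳ _)) e))

  -- The defining recursion of A peels rₗ; the count peels r₁.  The two agree.
  -- The embedding ℕ → ℤ on expressions of the shape a b + (c d) e.
  pos-shape : ∀ a b c d e → + (a *ℕ b +ℕ (c *ℕ d) *ℕ e) ≡ + a ℤ.* + b ℤ.+ (+ c ℤ.* + d) ℤ.* + e
  pos-shape a b c d e = ≡.trans (ℤP.pos-+ (a *ℕ b) ((c *ℕ d) *ℕ e))
    (≡.cong₂ ℤ._+_ (ℤP.pos-* a b) (≡.trans (ℤP.pos-* (c *ℕ d) e) (≡.cong (ℤ._* + e) (ℤP.pos-* c d))))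

  ψℤ-+ : ∀ m n → + ψ F (m +ℕ n) ≡ + ψ F m ℤ.* + ψ F n ℤ.+ (+ Z ℤ.* + φ F m) ℤ.* + φ F n
  ψℤ-+ m n = ≡.trans (≡.cong +_ (ψ-+ m n)) (pos-shape (ψ F m) (ψ F n) Z (φ F m) (φ F n))

  sum-snoc : ∀ ys x → ListAction.sum (ys ++ [ x ]) ≡ ListAction.sum ys +ℕ x
  sum-snoc ys x = ≡.trans (ListActionP.sum-++ ys [ x ]) (≡.cong (ListAction.sum ys +ℕ_) (ℕP.+-identityʳ x))

  Arev-snoc : ∀ ys x → ys ≢ [] → Arev F (ys ++ [ x ]) ≡ + φ F x ℤ.* + ψ F (ListAction.sum ys) ℤ.+ sgn x ℤ.* Arev F ys
  Arev-snoc []             x ys≢[] = ⊥-elim (ys≢[] ≡.refl)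
  Arev-snoc (y ∷ [])       x _     = begin
    + ψ F (x +ℕ 0) ℤ.* + φ F y ℤ.+ sgn y ℤ.* + ψ F x
      ≡⟨ ≡.cong (λ m → + ψ F m ℤ.* fy ℤ.+ sgn y ℤ.* + ψ F x) (ℕP.+-identityʳ x) ⟩
    + ψ F x ℤ.* fy ℤ.+ sgn y ℤ.* + ψ F x
      ≡⟨ ≡.cong (λ p → p ℤ.* fy ℤ.+ sgn y ℤ.* p) (ψ≡φ+sgn x) ⟩
    (fx ℤ.+ sgn x) ℤ.* fy ℤ.+ sgn y ℤ.* (fx ℤ.+ sgn x)
      ≡⟨ two-blocks fx fy (sgn x) (sgn y) ⟩
    fx ℤ.* (fy ℤ.+ sgn y) ℤ.+ sgn x ℤ.* (fy ℤ.+ sgn y)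
      ≡⟨ ≡.cong (λ p → fx ℤ.* p ℤ.+ sgn x ℤ.* p) (ψ≡φ+sgn y) ⟨
    fx ℤ.* + ψ F y ℤ.+ sgn x ℤ.* + ψ F y
      ≡⟨ ≡.cong (λ m → fx ℤ.* + ψ F m ℤ.+ sgn x ℤ.* + ψ F y) (ℕP.+-identityʳ y) ⟨
    fx ℤ.* + ψ F (y +ℕ 0) ℤ.+ sgn x ℤ.* + ψ F y
      ∎
    where
    open ≡.≡-Reasoning
    fx fy : ℤ
    fx = + φ F x
    fy = + φ F y
    two-blocks : ∀ fx fy ex ey → (fx ℤ.+ ex) ℤ.* fy ℤ.+ ey ℤ.* (fx ℤ.+ ex) ≡ fx ℤ.* (fy ℤ.+ ey) ℤ.+ ex ℤ.* (fy ℤ.+ ey)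
    two-blocks = solve-∀
  Arev-snoc (y ∷ ys@(_ ∷ _)) x _   = begin
    + ψ F (ListAction.sum (ys ++ [ x ])) ℤ.* fy ℤ.+ sgn y ℤ.* Arev F (ys ++ [ x ])
      ≡⟨ ≡.cong₂ (λ p a → p ℤ.* fy ℤ.+ sgn y ℤ.* a) (≡.cong (λ m → + ψ F m) (sum-snoc ys x)) (Arev-snoc ys x (λ ())) ⟩
    + ψ F (c +ℕ x) ℤ.* fy ℤ.+ sgn y ℤ.* (fx ℤ.* pc ℤ.+ sgn x ℤ.* Ar)
      ≡⟨ ≡.cong (λ p → p ℤ.* fy ℤ.+ sgn y ℤ.* (fx ℤ.* pc ℤ.+ sgn x ℤ.* Ar))
                (≡.trans (ψℤ-+ c x) (≡.cong (λ p → pc ℤ.* p ℤ.+ (+ Z ℤ.* fc) ℤ.* fx) (ψ≡φ+sgn x))) ⟩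
    (pc ℤ.* (fx ℤ.+ sgn x) ℤ.+ (+ Z ℤ.* fc) ℤ.* fx) ℤ.* fy ℤ.+ sgn y ℤ.* (fx ℤ.* pc ℤ.+ sgn x ℤ.* Ar)
      ≡⟨ three-blocks pc fc fx fy (sgn x) (sgn y) (+ Z) Ar ⟩
    fx ℤ.* ((fy ℤ.+ sgn y) ℤ.* pc ℤ.+ (+ Z ℤ.* fy) ℤ.* fc) ℤ.+ sgn x ℤ.* (pc ℤ.* fy ℤ.+ sgn y ℤ.* Ar)
      ≡⟨ ≡.cong (λ p → fx ℤ.* p ℤ.+ sgn x ℤ.* (pc ℤ.* fy ℤ.+ sgn y ℤ.* Ar))
                (≡.trans (≡.cong (λ p → p ℤ.* pc ℤ.+ (+ Z ℤ.* fy) ℤ.* fc) (≡.sym (ψ≡φ+sgn y))) (≡.sym (ψℤ-+ y c))) ⟩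
    fx ℤ.* + ψ F (y +ℕ c) ℤ.+ sgn x ℤ.* (pc ℤ.* fy ℤ.+ sgn y ℤ.* Ar)
      ∎
    where
    open ≡.≡-Reasoning
    c : ℕ
    c  = ListAction.sum ys
    Ar pc fc fx fy : ℤ
    Ar = Arev F ys
    pc = + ψ F c
    fc = + φ F c
    fx = + φ F x
    fy = + φ F y
    three-blocks : ∀ pc fc fx fy ex ey z ar →
      (pc ℤ.* (fx ℤ.+ ex) ℤ.+ (z ℤ.* fc) ℤ.* fx) ℤ.* fy ℤ.+ ey ℤ.* (fx ℤ.* pc ℤ.+ ex ℤ.* ar)
      ≡ fx ℤ.* ((fy ℤ.+ ey) ℤ.* pc ℤ.+ (z ℤ.* fy) ℤ.* fc) ℤ.+ ex ℤ.* (pc ℤ.* fy ℤ.+ ey ℤ.* ar)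
    three-blocks = solve-∀

  sum-tabulate : ∀ l (r : Fin l → ℕ) → ListAction.sum (tabulate r) ≡ sumFin _+ℕ_ 0 l r
  sum-tabulate zero    r = ≡.refl
  sum-tabulate (suc l) r = ≡.cong (r zero +ℕ_) (sum-tabulate l (rest r))

  A-front : ∀ k (r : Fin (suc (suc k)) → ℕ) →
            A F (suc (suc k)) r ≡ + φ F (r zero) ℤ.* + ψ F (sumFin _+ℕ_ 0 (suc k) (rest r)) ℤ.+ sgn (r zero) ℤ.* A F (suc k) (rest r)
  A-front k r = begin
    Arev F (reverse (r zero ∷ tabulate (rest r)))             ≡⟨ ≡.cong (Arev F) (unfold-reverse (r zero) (tabulate (rest r))) ⟩
    Arev F (reverse (tabulate (rest r)) ++ [ r zero ])        ≡⟨ Arev-snoc (reverse (tabulate (rest r))) (r zero) nonempty ⟩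
    + φ F (r zero) ℤ.* + ψ F (ListAction.sum (reverse (tabulate (rest r)))) ℤ.+ sgn (r zero) ℤ.* A F (suc k) (rest r)
      ≡⟨ ≡.cong (λ m → + φ F (r zero) ℤ.* + ψ F m ℤ.+ sgn (r zero) ℤ.* A F (suc k) (rest r))
                (≡.trans (ListActionP.sum-↭ (↭-reverse (tabulate (rest r)))) (sum-tabulate (suc k) (rest r))) ⟩
    + φ F (r zero) ℤ.* + ψ F (sumFin _+ℕ_ 0 (suc k) (rest r)) ℤ.+ sgn (r zero) ℤ.* A F (suc k) (rest r)
      ∎
    where
    open ≡.≡-Reasoning
    nonempty : reverse (tabulate (rest r)) ≢ []
    nonempty e with () ← ≡.trans (≡.sym (length-reverse (tabulate (rest r)))) (≡.cong length e)

  -- ψ X + (q-1) φ Y = φ (X + (q-1) Y) + (ψ - φ) X, with ψ - φ = (-1)^a.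
  front-step : ∀ a X Y → + (ψ F a *ℕ X +ℕ (Z *ℕ φ F a) *ℕ Y) ≡ + φ F a ℤ.* + (X +ℕ Z *ℕ Y) ℤ.+ sgn a ℤ.* + X
  front-step a X Y = begin
    + (ψ F a *ℕ X +ℕ (Z *ℕ φ F a) *ℕ Y)                        ≡⟨ pos-shape (ψ F a) X Z (φ F a) Y ⟩
    + ψ F a ℤ.* + X ℤ.+ (+ Z ℤ.* + φ F a) ℤ.* + Y
      ≡⟨ ≡.cong (λ p → p ℤ.* + X ℤ.+ (+ Z ℤ.* + φ F a) ℤ.* + Y) (ψ≡φ+sgn a) ⟩
    (+ φ F a ℤ.+ sgn a) ℤ.* + X ℤ.+ (+ Z ℤ.* + φ F a) ℤ.* + Y  ≡⟨ regroup (+ φ F a) (sgn a) (+ X) (+ Y) (+ Z) ⟩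
    + φ F a ℤ.* (+ X ℤ.+ + Z ℤ.* + Y) ℤ.+ sgn a ℤ.* + X        ≡⟨ ≡.cong (λ p → + φ F a ℤ.* p ℤ.+ sgn a ℤ.* + X) X+ZY ⟨
    + φ F a ℤ.* + (X +ℕ Z *ℕ Y) ℤ.+ sgn a ℤ.* + X              ∎
    where
    open ≡.≡-Reasoning
    X+ZY : + (X +ℕ Z *ℕ Y) ≡ + X ℤ.+ + Z ℤ.* + Y
    X+ZY = ≡.trans (ℤP.pos-+ X (Z *ℕ Y)) (≡.cong (λ p → + X ℤ.+ p) (ℤP.pos-* Z Y))
    regroup : ∀ f e x y z → (f ℤ.+ e) ℤ.* x ℤ.+ (z ℤ.* f) ℤ.* y ≡ f ℤ.* (x ℤ.+ z ℤ.* y) ℤ.+ e ℤ.* x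
    regroup = solve-∀

  count-A : ∀ k r α → (∀ i → ¬ α i ≈ 0#) → (∀ i j → i ≢ j → ¬ α i ≈ α j) →
            + M (suc k) r α 0# 0# ≡ A F (suc k) r
  count-A zero    r α _   _     = ≡.cong +_ (M-single r α)
  count-A (suc k) r α α≉0 α-inj = begin
    + M (suc (suc k)) r α 0# 0#                           ≡⟨ ≡.cong +_ (M-front (suc k) r α) ⟩
    + (ψ F (r zero) *ℕ X +ℕ (Z *ℕ φ F (r zero)) *ℕ Y)     ≡⟨ front-step (r zero) X Y ⟩
    + φ F (r zero) ℤ.* + (X +ℕ Z *ℕ Y) ℤ.+ sgn (r zero) ℤ.* + X
      ≡⟨ ≡.cong₂ (λ m a → + φ F (r zero) ℤ.* + m ℤ.+ sgn (r zero) ℤ.* a)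
                 (≡.sym (ψ-total (suc k) (rest r) β β≉0)) (count-A k (rest r) β β≉0 β-inj) ⟩
    + φ F (r zero) ℤ.* + ψ F (sumFin _+ℕ_ 0 (suc k) (rest r)) ℤ.+ sgn (r zero) ℤ.* A F (suc k) (rest r)
      ≡⟨ A-front k r ⟨
    A F (suc (suc k)) r                                   ∎
    where
    open ≡.≡-Reasoning
    β : Fin (suc k) → Carrier
    β = rebase α
    X Y : ℕ
    X = M (suc k) (rest r) β 0# 0#
    Y = M (suc k) (rest r) β 1# 0#
    β≉0 : ∀ i → ¬ β i ≈ 0#
    β≉0 i e = α-inj (suc i) zero (λ ()) (x∙y⁻¹≈ε⇒x≈y (α (suc i)) (α zero) e)
    β-inj : ∀ i j → i ≢ j → ¬ β i ≈ β j
    β-inj i j i≢j e = α-inj (suc i) (suc j) (λ e′ → i≢j (suc-injective e′)) (∙-cancelʳ (- α zero) _ _ e)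

  count-γ≉0 : ∀ k r α → (∀ i → ¬ α i ≈ 0#) → (∀ i j → i ≢ j → ¬ α i ≈ α j) → ∀ {γ} → ¬ γ ≈ 0# →
              (+ q ℤ.- + 1) ℤ.* + M (suc k) r α γ 0# ≡ + ψ F (sumFin _+ℕ_ 0 (suc k) r) ℤ.- A F (suc k) r
  count-γ≉0 k r α α≉0 α-inj γ≉0 = begin
    (+ q ℤ.- + 1) ℤ.* + M (suc k) r α _ 0#                ≡⟨ ≡.cong₂ ℤ._*_ q-1≡Z (≡.cong +_ (M-radial (suc k) r α γ≉0)) ⟩
    + Z ℤ.* + M₁                                          ≡⟨ ℤP.pos-* Z M₁ ⟨
    + (Z *ℕ M₁)                                           ≡⟨ difference (ψ-total (suc k) r α α≉0) ⟩
    + ψ F (sumFin _+ℕ_ 0 (suc k) r) ℤ.- + M₀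
      ≡⟨ ≡.cong (λ a → + ψ F (sumFin _+ℕ_ 0 (suc k) r) ℤ.- a) (count-A k r α α≉0 α-inj) ⟩
    + ψ F (sumFin _+ℕ_ 0 (suc k) r) ℤ.- A F (suc k) r     ∎
    where
    open ≡.≡-Reasoning
    M₀ M₁ : ℕ
    M₀ = M (suc k) r α 0# 0#
    M₁ = M (suc k) r α 1# 0#
    difference : ∀ {a b c} → c ≡ a +ℕ b → + b ≡ + c ℤ.- + a
    difference {a} {b} ≡.refl = ≡.trans (add-sub (+ b) (+ a)) (≡.cong (ℤ._- + a) (ℤP.pos-+ a b))
      where
      add-sub : ∀ x y → x ≡ (y ℤ.+ x) ℤ.- y
      add-sub = solve-∀
    q-1≡Z : + q ℤ.- + 1 ≡ + Z
    q-1≡Z = ≡.sym (difference (≡.trans (≡.sym Z+1≡q) (ℕP.+-comm Z 1)))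

open import Data.Nat using (ℕ; suc; _≥_) renaming (_+_ to _+ℕ_)
open import Data.Fin using (Fin) renaming (zero to fzero)
open import Data.Integer using (+_; _-_; _*_)
open import Data.Product using (_×_; _,_)
open import Relation.Nullary using (¬_)
open import Relation.Binary.PropositionalEquality using (_≡_; _≢_; cong; trans)

-- One block: M-single and M-single-off; two or more blocks: count-A and count-γ≉0.
proposition4 : (F : FiniteField) (k : ℕ) (r : Fin (suc k) → ℕ)
    (α : Fin (suc k) → FiniteField.Carrier F) (γ : FiniteField.Carrier F) →
    (∀ i → r i ≥ 1) →
    (∀ i → ¬ FiniteField._≈_ F (α i) (FiniteField.0# F)) →
    (∀ i j → i ≢ j → ¬ FiniteField._≈_ F (α i) (α j)) →
    (k ≡ 0 →
       ((FiniteField._≈_ F γ (FiniteField.0# F) → nSolutions F (suc k) r α γ ≡ ψ F (r fzero))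
        × (¬ FiniteField._≈_ F γ (FiniteField.0# F) → nSolutions F (suc k) r α γ ≡ 0)))
    × (k ≥ 1 →
       ((FiniteField._≈_ F γ (FiniteField.0# F) → + nSolutions F (suc k) r α γ ≡ A F (suc k) r)
        × (¬ FiniteField._≈_ F γ (FiniteField.0# F) →
             (+ FiniteField.q F - + 1) * + nSolutions F (suc k) r α γ
               ≡ + ψ F (sumFin _+ℕ_ 0 (suc k) r) - A F (suc k) r)))
proposition4 F 0 r α γ _ α≉0 _ =
  (λ _ → (λ γ≈0 → trans (nSolutions≡M 1 r α γ) (trans (M-cong 1 r α γ≈0 refl) (M-single r α)))
       , (λ γ≉0 → trans (nSolutions≡M 1 r α γ) (M-single-off r α (α≉0 fzero) γ≉0)))
  , λ ()
  where open Counting F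
        open FiniteField F using (refl)
proposition4 F (suc k) r α γ _ α≉0 α-inj =
  (λ ())
  , λ _ → (λ γ≈0 → trans (cong +_ (trans (nSolutions≡M l r α γ) (M-cong l r α γ≈0 refl))) (count-A (suc k) r α α≉0 α-inj))
        , (λ γ≉0 → trans (cong (λ n → (+ q - + 1) * + n) (nSolutions≡M l r α γ)) (count-γ≉0 (suc k) r α α≉0 α-inj γ≉0))
  where open Counting F
        open FiniteField F using (refl; q)
        l : ℕ
        l = suc (suc k)
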